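{- Let $G$ be a loopless graph and let $\Theta$ be the kernel of the action of $\mathrm{Aut}(G)$ on $V(G)$. Then $\mathrm{Aut}(G)$ has a subgroup $\Sigma$ acting faithfully on $V(G)$ such that $\mathrm{Aut}(G)=\Sigma\Theta$.
   Context: Graphs are finite and undirected and may have parallel edges. An automorphism of $G$ is a bijection of $V(G)\cup E(G)$ mapping $V(G)$ onto $V(G)$ and $E(G)$ onto $E(G)$ and preserving incidence; $\mathrm{Aut}(G)$ is the group of all automorphisms. Because of parallel edges, $\mathrm{Aut}(G)$ need not act faithfully on $V(G)$. -}

module Defs where

open import Data.Nat using (ℕ)
open import Data.Fin using (Fin)
open import Data.Fin.Permutation as P using (Permutation′; _⟨$⟩ʳ_; _⟨$⟩ˡ_)
open import Data.Product using (_×_; _,_; proj₁; proj₂; Σ; ∃; ∃-syntax)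
open import Data.Sum using (_⊎_)
open import Function.Bundles using (_⇔_; mk⇔; Equivalence)
import Function.Properties.Equivalence as Eqv
open import Relation.Binary.PropositionalEquality using (_≡_; _≢_; subst; sym)
open import Relation.Nullary using (¬_)
open import Level using (Level; suc; _⊔_)

-- A finite (multi)graph: vertex set Fin nV, edge set Fin nE; each edge has two
-- ends (possibly equal = a loop).  Parallel edges are allowed.
-- Undirectedness: only the incidence relation (symmetric in the two ends) is
-- used by automorphisms, so the order of the ends carries no information.
record Graph : Set where
  field
    nV   : ℕ
    nE   : ℕ
    ends : Fin nE → Fin nV × Fin nV

open Graph public

Incident : (G : Graph) → Fin (nE G) → Fin (nV G) → Set
Incident G e v = (v ≡ proj₁ (ends G e)) ⊎ (v ≡ proj₂ (ends G e))

Loopless : Graph → Set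
Loopless G = ∀ e → proj₁ (ends G e) ≢ proj₂ (ends G e)

record Aut (G : Graph) : Set where
  field
    vperm : Permutation′ (nV G)
    eperm : Permutation′ (nE G)
    preserves : ∀ e v → Incident G e v ⇔ Incident G (eperm ⟨$⟩ʳ e) (vperm ⟨$⟩ʳ v)

open Aut public

module _ {G : Graph} where

  _≈ᴬ_ : Aut G → Aut G → Set
  a ≈ᴬ b = (∀ v → vperm a ⟨$⟩ʳ v ≡ vperm b ⟨$⟩ʳ v) × (∀ e → eperm a ⟨$⟩ʳ e ≡ eperm b ⟨$⟩ʳ e)

  idᴬ : Aut G
  idᴬ = record { vperm = P.id ; eperm = P.id ; preserves = λ e v → Eqv.refl }

  -- composition: (a ∘ᴬ b) x = a (b x)
  _∘ᴬ_ : Aut G → Aut G → Aut G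
  a ∘ᴬ b = record
    { vperm = vperm b P.∘ₚ vperm a
    ; eperm = eperm b P.∘ₚ eperm a
    ; preserves = λ e v → Eqv.trans (preserves b e v)
                            (preserves a (eperm b ⟨$⟩ʳ e) (vperm b ⟨$⟩ʳ v)) }

  Inc-cong : ∀ {e e′ v v′} → e ≡ e′ → v ≡ v′ → Incident G e v ⇔ Incident G e′ v′
  Inc-cong p q = mk⇔ (λ x → subst (λ w → Incident G _ w) q (subst (λ f → Incident G f _) p x))
                     (λ x → subst (λ w → Incident G _ w) (sym q) (subst (λ f → Incident G f _) (sym p) x))

  invᴬ : Aut G → Aut G
  invᴬ a = record
    { vperm = P.flip (vperm a)
    ; eperm = P.flip (eperm a)
    ; preserves = λ e v →
        Eqv.sym (Eqv.trans (preserves a (eperm a ⟨$⟩ˡ e) (vperm a ⟨$⟩ˡ v))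
                           (Inc-cong (P.inverseʳ (eperm a)) (P.inverseʳ (vperm a)))) }

  record IsSubgroup (S : Aut G → Set) : Set where
    field
      resp    : ∀ {a b} → a ≈ᴬ b → S a → S b
      has-id  : S idᴬ
      ∘-closed : ∀ {a b} → S a → S b → S (a ∘ᴬ b)
      inv-closed : ∀ {a} → S a → S (invᴬ a)

  Kernel : Aut G → Set
  Kernel a = ∀ v → vperm a ⟨$⟩ʳ v ≡ v

  ActsFaithfully : (Aut G → Set) → Set
  ActsFaithfully S = ∀ a → S a → Kernel a → a ≈ᴬ idᴬ

  IsProductWithKernel : (Aut G → Set) → Set
  IsProductWithKernel S = ∀ a → ∃[ s ] ∃[ t ] (S s × Kernel t × a ≈ᴬ (s ∘ᴬ t))

{-# OPTIONS --safe #-}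
-- Call two edges parallel when they are incident with the same vertices, and
-- number the edges of each parallel class 0, 1, 2, … in the order of Fin.
-- Σ consists of the automorphisms that preserve these numbers.  An element of
-- the kernel Θ maps every edge to a parallel one, so in Σ it is the identity.
-- Any automorphism a permutes the parallel classes; replacing its action on
-- the edges by the order-preserving bijection between each class and its image
-- gives s ∈ Σ with the same action on V(G), and then s⁻¹ a ∈ Θ.
module Submission where

open import Defs
open import Data.Product using (_×_; Σ; _,_; proj₁; proj₂; ∃-syntax)
open import Data.Nat using (ℕ; zero; suc; _+_; _<_; s≤s; z≤n)
open import Data.Nat.Properties using (+-cancelˡ-≡; +-monoʳ-<; +-0-commutativeMonoid)
open import Data.Bool using (Bool; true; false)
open import Data.Fin using (Fin; zero; suc) renaming (_≟_ to _≟ᶠ_)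
open import Data.Fin.Properties using (all?)
open import Data.Fin.Permutation as P using (Permutation′; _⟨$⟩ʳ_; _⟨$⟩ˡ_)
open import Function using (_∘_)
open import Function.Bundles using (_⇔_; mk⇔; Equivalence)
import Function.Properties.Equivalence as Eqv
open import Relation.Binary.Core using (Rel)
open import Relation.Binary.Structures using (IsDecEquivalence)
open import Relation.Binary.PropositionalEquality
open import Relation.Nullary using (Dec; yes; does)
open import Relation.Nullary.Decidable using (dec-true; does-⇔; map′; _×-dec_; _→-dec_; _⊎-dec_)
import Algebra.Properties.CommutativeMonoid.Sum +-0-commutativeMonoid as ℕSum

does-true⇒ : ∀ {a} {A : Set a} (a? : Dec A) → does a? ≡ true → A
does-true⇒ (yes a) _ = a

_⇔-dec_ : ∀ {a b} {A : Set a} {B : Set b} → Dec A → Dec B → Dec (A ⇔ B)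
a? ⇔-dec b? = map′ (λ (f , g) → mk⇔ f g) (λ e → Equivalence.to e , Equivalence.from e)
                   ((a? →-dec b?) ×-dec (b? →-dec a?))

fromBool : Bool → ℕ
fromBool true  = 1
fromBool false = 0

count : ∀ {n} → (Fin n → Bool) → ℕ
count p = ℕSum.sum (fromBool ∘ p)

rank : ∀ {n} → (Fin n → Bool) → Fin n → ℕ
rank {suc n} p zero    = 0
rank {suc n} p (suc x) = fromBool (p zero) + rank (p ∘ suc) x

rank<count : ∀ {n} (p : Fin n → Bool) {x} → p x ≡ true → rank p x < count p
rank<count {suc n} p {zero}  px rewrite px = s≤s z≤n
rank<count {suc n} p {suc x} px = +-monoʳ-< (fromBool (p zero)) (rank<count (p ∘ suc) px)

rank-injective : ∀ {n} (p : Fin n → Bool) {x y} → p x ≡ true → p y ≡ true →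
                 rank p x ≡ rank p y → x ≡ y
rank-injective {suc n} p {zero}  {zero}  px py eq = refl
rank-injective {suc n} p {zero}  {suc y} px py eq rewrite px with () ← eq
rank-injective {suc n} p {suc x} {zero}  px py eq rewrite py with () ← eq
rank-injective {suc n} p {suc x} {suc y} px py eq =
  cong suc (rank-injective (p ∘ suc) px py (+-cancelˡ-≡ (fromBool (p zero)) _ _ eq))

rank-onto : ∀ {n} (p : Fin n → Bool) {r} → r < count p → ∃[ x ] (p x ≡ true × rank p x ≡ r)
rank-onto {suc n} p {r} r<count with p zero in p0
rank-onto {suc n} p {zero}  _             | true  = zero , p0 , refl
rank-onto {suc n} p {suc r} (s≤s r<count) | true  =
  let x , px , rank≡r = rank-onto (p ∘ suc) r<count
  in  suc x , px , cong₂ _+_ (cong fromBool p0) rank≡r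
rank-onto {suc n} p {r}     r<count       | false =
  let x , px , rank≡r = rank-onto (p ∘ suc) r<count
  in  suc x , px , cong₂ _+_ (cong fromBool p0) rank≡r

count-cong : ∀ {n} {p q : Fin n → Bool} → (∀ x → p x ≡ q x) → count p ≡ count q
count-cong p≗q = ℕSum.sum-cong-≗ (cong fromBool ∘ p≗q)

rank-cong : ∀ {n} {p q : Fin n → Bool} → (∀ x → p x ≡ q x) → ∀ x → rank p x ≡ rank q x
rank-cong {suc n} p≗q zero    = refl
rank-cong {suc n} p≗q (suc x) = cong₂ _+_ (cong fromBool (p≗q zero)) (rank-cong (p≗q ∘ suc) x)

count-permute : ∀ {n} (p : Fin n → Bool) (π : Permutation′ n) → count p ≡ count (p ∘ (π ⟨$⟩ʳ_))
count-permute p π = ℕSum.sum-permute (fromBool ∘ p) π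

module ClassRank {n ℓ} {_~_ : Rel (Fin n) ℓ} (isDecEquivalence : IsDecEquivalence _~_) where
  open IsDecEquivalence isDecEquivalence using ()
    renaming (_≟_ to _~?_; refl to ~-refl; sym to ~-sym; trans to ~-trans)

  classOf : Fin n → Fin n → Bool
  classOf x y = does (y ~? x)

  classOf-self : ∀ x → classOf x x ≡ true
  classOf-self x = dec-true (x ~? x) ~-refl

  classOf-cong : ∀ {x y} → x ~ y → ∀ z → classOf x z ≡ classOf y z
  classOf-cong {x} {y} x~y z =
    does-⇔ (mk⇔ (λ z~x → ~-trans z~x x~y) (λ z~y → ~-trans z~y (~-sym x~y))) (z ~? x) (z ~? y)

  classRank : Fin n → ℕ
  classRank x = rank (classOf x) x

  classRank-injective : ∀ {x y} → x ~ y → classRank x ≡ classRank y → x ≡ y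
  classRank-injective {x} {y} x~y eq =
    rank-injective (classOf y) (dec-true (x ~? y) x~y) (classOf-self y)
      (trans (sym (rank-cong (classOf-cong x~y) x)) eq)

  Respects : Permutation′ n → Set ℓ
  Respects π = ∀ {x y} → x ~ y ⇔ (π ⟨$⟩ʳ x) ~ (π ⟨$⟩ʳ y)

  flip-respects : ∀ π → Respects π → Respects (P.flip π)
  flip-respects π resp {x} {y} =
    Eqv.sym (Eqv.trans resp (mk⇔ (subst₂ _~_ (P.inverseʳ π) (P.inverseʳ π))
                                  (subst₂ _~_ (sym (P.inverseʳ π)) (sym (P.inverseʳ π)))))

  count-classOf-image : ∀ π → Respects π → ∀ x → count (classOf x) ≡ count (classOf (π ⟨$⟩ʳ x))
  count-classOf-image π resp x = begin
    count (classOf x)                       ≡⟨ count-cong (λ y → does-⇔ resp (y ~? x) (π ⟨$⟩ʳ y ~? π ⟨$⟩ʳ x)) ⟩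
    count (classOf (π ⟨$⟩ʳ x) ∘ (π ⟨$⟩ʳ_))  ≡⟨ count-permute (classOf (π ⟨$⟩ʳ x)) π ⟨
    count (classOf (π ⟨$⟩ʳ x))              ∎
    where open ≡-Reasoning

  module _ (π : Permutation′ n) (resp : Respects π) (x : Fin n) where
    private
      chosen : ∃[ y ] (classOf (π ⟨$⟩ʳ x) y ≡ true × rank (classOf (π ⟨$⟩ʳ x)) y ≡ classRank x)
      chosen = rank-onto (classOf (π ⟨$⟩ʳ x))
        (subst (classRank x <_) (count-classOf-image π resp x) (rank<count (classOf x) (classOf-self x)))

    realign : Fin n
    realign = proj₁ chosen

    realign-~ : realign ~ (π ⟨$⟩ʳ x)
    realign-~ = does-true⇒ (realign ~? (π ⟨$⟩ʳ x)) (proj₁ (proj₂ chosen))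

    realign-classRank : classRank realign ≡ classRank x
    realign-classRank = trans (rank-cong (classOf-cong realign-~) realign) (proj₂ (proj₂ chosen))

  realign-inverse : ∀ π ρ (π-resp : Respects π) (ρ-resp : Respects ρ) →
                    (∀ x → ρ ⟨$⟩ʳ (π ⟨$⟩ʳ x) ≡ x) → ∀ x → realign ρ ρ-resp (realign π π-resp x) ≡ x
  realign-inverse π ρ π-resp ρ-resp ρπ≡id x = classRank-injective
    (~-trans (realign-~ ρ ρ-resp (realign π π-resp x))
             (subst (λ y → (ρ ⟨$⟩ʳ realign π π-resp x) ~ y) (ρπ≡id x)
                    (Equivalence.to ρ-resp (realign-~ π π-resp x))))
    (trans (realign-classRank ρ ρ-resp (realign π π-resp x)) (realign-classRank π π-resp x))

  realignₚ : ∀ π → Respects π → Permutation′ n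
  realignₚ π resp = P.permutation (realign π resp) (realign π⁻¹ (flip-respects π resp))
    (realign-inverse π⁻¹ π (flip-respects π resp) resp (λ _ → P.inverseʳ π))
    (realign-inverse π π⁻¹ resp (flip-respects π resp) (λ _ → P.inverseˡ π))
    where π⁻¹ = P.flip π

module _ (G : Graph) where

  Parallel : Rel (Fin (nE G)) _
  Parallel e f = ∀ v → Incident G e v ⇔ Incident G f v

  parallel-isDecEquivalence : IsDecEquivalence Parallel
  parallel-isDecEquivalence = record
    { isEquivalence = record
      { refl  = λ v → Eqv.refl
      ; sym   = λ e∥f v → Eqv.sym (e∥f v)
      ; trans = λ e∥f f∥g v → Eqv.trans (e∥f v) (f∥g v) }
    ; _≟_ = λ e f → all? λ v → incident? e v ⇔-dec incident? f v }
    where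
    incident? : ∀ e v → Dec (Incident G e v)
    incident? e v = (v ≟ᶠ proj₁ (ends G e)) ⊎-dec (v ≟ᶠ proj₂ (ends G e))

  open ClassRank parallel-isDecEquivalence

  incident-resp : ∀ e {v w} → v ≡ w → Incident G e v ⇔ Incident G e w
  incident-resp e refl = Eqv.refl

  aut-respects-parallel : (a : Aut G) → Respects (eperm a)
  aut-respects-parallel a {e} {f} = mk⇔ forth back
    where
    σ = vperm a
    forth : Parallel e f → Parallel (eperm a ⟨$⟩ʳ e) (eperm a ⟨$⟩ʳ f)
    forth e∥f v = Eqv.trans (incident-resp (eperm a ⟨$⟩ʳ e) (sym (P.inverseʳ σ)))
      (Eqv.trans (Eqv.sym (preserves a e (σ ⟨$⟩ˡ v)))
        (Eqv.trans (e∥f (σ ⟨$⟩ˡ v))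
          (Eqv.trans (preserves a f (σ ⟨$⟩ˡ v)) (incident-resp (eperm a ⟨$⟩ʳ f) (P.inverseʳ σ)))))
    back : Parallel (eperm a ⟨$⟩ʳ e) (eperm a ⟨$⟩ʳ f) → Parallel e f
    back ae∥af v =
      Eqv.trans (preserves a e v) (Eqv.trans (ae∥af (σ ⟨$⟩ʳ v)) (Eqv.sym (preserves a f v)))

  kernel-parallel : ∀ a → Kernel a → ∀ e → Parallel (eperm a ⟨$⟩ʳ e) e
  kernel-parallel a fixes e v =
    Eqv.trans (incident-resp (eperm a ⟨$⟩ʳ e) (sym (fixes v))) (Eqv.sym (preserves a e v))

  withEdgePermutation : (a : Aut G) (ρ : Permutation′ (nE G)) →
                        (∀ e → Parallel (ρ ⟨$⟩ʳ e) (eperm a ⟨$⟩ʳ e)) → Aut G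
  withEdgePermutation a ρ ρ∥a = record
    { vperm = vperm a
    ; eperm = ρ
    ; preserves = λ e v → Eqv.trans (preserves a e v) (Eqv.sym (ρ∥a e (vperm a ⟨$⟩ʳ v))) }

  RankPreserving : Aut G → Set
  RankPreserving a = ∀ e → classRank (eperm a ⟨$⟩ʳ e) ≡ classRank e

  rankPreserving-isSubgroup : IsSubgroup RankPreserving
  rankPreserving-isSubgroup = record
    { resp       = λ {a} a≈b a-pres e →
        subst (λ f → classRank f ≡ classRank e) (proj₂ a≈b e) (a-pres e)
    ; has-id     = λ e → refl
    ; ∘-closed   = λ {a} {b} a-pres b-pres e → trans (a-pres (eperm b ⟨$⟩ʳ e)) (b-pres e)
    ; inv-closed = λ {a} a-pres e →
        trans (sym (a-pres (eperm a ⟨$⟩ˡ e))) (cong classRank (P.inverseʳ (eperm a))) }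

  rankPreserving-actsFaithfully : ActsFaithfully RankPreserving
  rankPreserving-actsFaithfully a a-pres fixes =
    fixes , λ e → classRank-injective (kernel-parallel a fixes e) (a-pres e)

  rankPreservingPart : Aut G → Aut G
  rankPreservingPart a =
    withEdgePermutation a (realignₚ (eperm a) (aut-respects-parallel a))
      (realign-~ (eperm a) (aut-respects-parallel a))

  rankPreserving×kernel : IsProductWithKernel RankPreserving
  rankPreserving×kernel a =
    s , invᴬ s ∘ᴬ a , realign-classRank (eperm a) (aut-respects-parallel a) ,
    (λ v → P.inverseˡ (vperm a)) ,
    (λ v → sym (P.inverseʳ (vperm a))) , (λ e → sym (P.inverseʳ (eperm s)))
    where s = rankPreservingPart a

lemma4p3 : (G : Graph) → Loopless G →
    Σ (Aut G → Set) (λ S → IsSubgroup S × ActsFaithfully S × IsProductWithKernel S)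
lemma4p3 G _ =
  RankPreserving G , rankPreserving-isSubgroup G ,
  rankPreserving-actsFaithfully G , rankPreserving×kernel G
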